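{- Let $t$ be a closed System T term of type $(\iota\Rightarrow\iota)\Rightarrow\iota$ and let $m:=[\![\mathsf{modulusUni}^T\,(\mathsf{dialogueTree}_\iota(t))]\!]\in\mathbb{N}$. Then $m$ is a modulus of uniform continuity of $[\![t]\!]\circ\mathsf{embed}:(\mathbb{N}\to\mathbb{B})\to\mathbb{N}$, i.e. for all $\alpha,\beta:\mathbb{N}\to\mathbb{B}$, if $\alpha(i)=\beta(i)$ for all $i<m$ then $[\![t]\!](\mathsf{embed}\,\alpha)=[\![t]\!](\mathsf{embed}\,\beta)$.
   Context: Metatheory: constructive Martin-Löf type theory without function extensionality; $\mathbb{B}$ is the type of booleans; $\mathsf{Natrec}\,f\,x\,0=x$, $\mathsf{Natrec}\,f\,x\,(n+1)=f\,n\,(\mathsf{Natrec}\,f\,x\,n)$. $\mathsf{embed}:(\mathbb{N}\to\mathbb{B})\to(\mathbb{N}\to\mathbb{N})$ is $\mathsf{embed}\,\alpha\,i=0$ if $\alpha\,i=\mathsf{false}$ and $1$ if $\alpha\,i=\mathsf{true}$. System T: types generated by base type $\iota$ and $\sigma\Rightarrow\tau$; terms: variables, $\mathsf{zero}:\iota$, $\mathsf{succ}\,t$, $\mathsf{rec}_\sigma\,t\,p\,q:\sigma$ ($t:\iota\Rightarrow\sigma\Rightarrow\sigma$, $p:\sigma$, $q:\iota$), $\lambda$-abstraction and application. Set interpretation: $[\![\iota]\!]=\mathbb{N}$, $[\![\sigma\Rightarrow\tau]\!]=[\![\sigma]\!]\to[\![\tau]\!]$, $[\![\mathsf{zero}]\!]=0$,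 $[\![\mathsf{succ}\,t]\!]\gamma=[\![t]\!]\gamma+1$, $[\![\mathsf{rec}_\sigma t_1t_2t_3]\!]\gamma=\mathsf{Natrec}([\![t_1]\!]\gamma)([\![t_2]\!]\gamma)([\![t_3]\!]\gamma)$, standard clauses otherwise; $[\![t]\!]$ for closed $t$. Numerals: $\underline0=\mathsf{zero}$, $\underline{n+1}=\mathsf{succ}\,\underline n$. Internal dialogue trees: $\mathsf{ChD}_A(\sigma):=(\sigma\Rightarrow A)\Rightarrow((\iota\Rightarrow A)\Rightarrow\iota\Rightarrow A)\Rightarrow A$; $\eta_A:=\lambda z\,e\,b.\,e\,z$; $\beta_A:=\lambda\varphi\,x\,e\,b.\,b\,(\lambda y.\varphi\,y\,e\,b)\,x$; $K_A:=\lambda f\,d\,e'\,b'.\,d\,(\lambda x.f\,x\,e'\,b')\,b'$; $\mathsf{map}_A:=\lambda f.K_A(\lambda x.\eta_A(f\,x))$. $\lceil\iota\rceil_A=\mathsf{ChD}_A(\iota)$, $\lceil\sigma\Rightarrow\tau\rceil_A=\lceil\sigma\rceil_A\Rightarrow\lceil\tau\rceil_A$. $\mathsf{ext}^T_{\iota,A}:=K_A$, $\mathsf{ext}^T_{\sigma_1\Rightarrow\sigma_2,A}:=\lambda f\,d\,s.\mathsf{ext}^T_{\sigma_2,A}(\lambda x.f\,x\,s)\,d$. Term translation: $\lceil x\rceil_A=x$, $\lceil\mathsf{zero}\rceil_A=\eta_A\,\mathsf{zero}$, $\lceil\mathsf{succ}\,t\rceil_A=\mathsf{map}_A(\lambda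 n.\mathsf{succ}\,n)\lceil t\rceil_A$, $\lceil\mathsf{rec}_\sigma t_1t_2t_3\rceil_A=\mathsf{ext}^T_{\sigma,A}(\lambda n.\mathsf{rec}_{\lceil\sigma\rceil_A}(\lambda x.\lceil t_1\rceil_A(\eta_A x))\lceil t_2\rceil_A\,n)\lceil t_3\rceil_A$, $\lambda$ and application homomorphically. $\mathsf{generic}_A:=K_A(\lambda i.\beta_A\,\eta_A\,i)$; $\mathsf{dialogueTree}_A(t):=\lceil t\rceil_A\,\mathsf{generic}_A$. Fix a closed term $\mathsf{max}^T:\iota\Rightarrow\iota\Rightarrow\iota$ with $[\![\mathsf{max}^T]\!]\,a\,b=\max(a,b)$. $\mathsf{maxBQ}^T:=\lambda d.\,d\,(\lambda w.\mathsf{zero})\,(\lambda g\,x.\,\mathsf{max}^T\,x\,(\mathsf{max}^T\,(g\,\underline0)\,(g\,\underline1)))$ of type $\mathsf{ChD}_\iota(\iota)\Rightarrow\iota$, and $\mathsf{modulusUni}^T:=\lambda d.\,\mathsf{succ}(\mathsf{maxBQ}^T\,d)$. -}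

module Defs where

open import Data.Nat using (ℕ; zero; suc)
open import Data.Bool using (Bool; true; false)
open import Data.Unit using (⊤; tt)
open import Data.Product using (_×_; _,_; proj₁; proj₂)

Natrec : {X : Set} → (ℕ → X → X) → X → ℕ → X
Natrec f x zero    = x
Natrec f x (suc n) = f n (Natrec f x n)

embed : (ℕ → Bool) → (ℕ → ℕ)
embed α i with α i
... | false = 0
... | true  = 1

infixr 7 _⇒_
data Type : Set where
  ι   : Type
  _⇒_ : Type → Type → Type

infixl 5 _,,_
data Cxt : Set where
  ε    : Cxt
  _,,_ : Cxt → Type → Cxt

data _∋_ : Cxt → Type → Set where
  here  : ∀ {Γ σ} → (Γ ,, σ) ∋ σ
  there : ∀ {Γ σ τ} → Γ ∋ σ → (Γ ,, τ) ∋ σ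

infixl 6 _·_
data T (Γ : Cxt) : Type → Set where
  ν    : ∀ {σ} → Γ ∋ σ → T Γ σ
  Zero : T Γ ι
  Succ : T Γ ι → T Γ ι
  Rec  : ∀ {σ} → T Γ (ι ⇒ σ ⇒ σ) → T Γ σ → T Γ ι → T Γ σ
  ƛ    : ∀ {σ τ} → T (Γ ,, σ) τ → T Γ (σ ⇒ τ)
  _·_  : ∀ {σ τ} → T Γ (σ ⇒ τ) → T Γ σ → T Γ τ

numeral : ∀ {Γ} → ℕ → T Γ ι
numeral zero    = Zero
numeral (suc n) = Succ (numeral n)

Ren : Cxt → Cxt → Set
Ren Γ Δ = ∀ {σ} → Γ ∋ σ → Δ ∋ σ

liftRen : ∀ {Γ Δ τ} → Ren Γ Δ → Ren (Γ ,, τ) (Δ ,, τ)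
liftRen ρ here      = here
liftRen ρ (there i) = there (ρ i)

ren : ∀ {Γ Δ σ} → Ren Γ Δ → T Γ σ → T Δ σ
ren ρ (ν i)         = ν (ρ i)
ren ρ Zero          = Zero
ren ρ (Succ t)      = Succ (ren ρ t)
ren ρ (Rec t p q)   = Rec (ren ρ t) (ren ρ p) (ren ρ q)
ren ρ (ƛ t)         = ƛ (ren (liftRen ρ) t)
ren ρ (t · u)       = ren ρ t · ren ρ u

wk : ∀ {Γ σ τ} → T Γ σ → T (Γ ,, τ) σ
wk = ren there

close : ∀ {Γ σ} → T ε σ → T Γ σ
close = ren (λ ())

v0 : ∀ {Γ σ} → T (Γ ,, σ) σ
v0 = ν here
v1 : ∀ {Γ σ τ} → T (Γ ,, σ ,, τ) σ
v1 = ν (there here)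
v2 : ∀ {Γ σ τ₁ τ₂} → T (Γ ,, σ ,, τ₁ ,, τ₂) σ
v2 = ν (there (there here))
v3 : ∀ {Γ σ τ₁ τ₂ τ₃} → T (Γ ,, σ ,, τ₁ ,, τ₂ ,, τ₃) σ
v3 = ν (there (there (there here)))
v4 : ∀ {Γ σ τ₁ τ₂ τ₃ τ₄} → T (Γ ,, σ ,, τ₁ ,, τ₂ ,, τ₃ ,, τ₄) σ
v4 = ν (there (there (there (there here))))

⟦_⟧ty : Type → Set
⟦ ι ⟧ty     = ℕ
⟦ σ ⇒ τ ⟧ty = ⟦ σ ⟧ty → ⟦ τ ⟧ty

⟦_⟧cxt : Cxt → Set
⟦ ε ⟧cxt      = ⊤
⟦ Γ ,, σ ⟧cxt = ⟦ Γ ⟧cxt × ⟦ σ ⟧ty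

lookupEnv : ∀ {Γ σ} → Γ ∋ σ → ⟦ Γ ⟧cxt → ⟦ σ ⟧ty
lookupEnv here      (γ , x) = x
lookupEnv (there i) (γ , x) = lookupEnv i γ

⟦_⟧ : ∀ {Γ σ} → T Γ σ → ⟦ Γ ⟧cxt → ⟦ σ ⟧ty
⟦ ν i ⟧ γ       = lookupEnv i γ
⟦ Zero ⟧ γ      = 0
⟦ Succ t ⟧ γ    = suc (⟦ t ⟧ γ)
⟦ Rec t p q ⟧ γ = Natrec (⟦ t ⟧ γ) (⟦ p ⟧ γ) (⟦ q ⟧ γ)
⟦ ƛ t ⟧ γ       = λ x → ⟦ t ⟧ (γ , x)
⟦ t · u ⟧ γ     = ⟦ t ⟧ γ (⟦ u ⟧ γ)

⟦_⟧₀ : ∀ {σ} → T ε σ → ⟦ σ ⟧ty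
⟦ t ⟧₀ = ⟦ t ⟧ tt

-- internal dialogue trees
ChD : Type → Type → Type
ChD A σ = (σ ⇒ A) ⇒ ((ι ⇒ A) ⇒ ι ⇒ A) ⇒ A

-- η_A = λ z e b. e z
ηT : ∀ {Γ A σ} → T Γ (σ ⇒ ChD A σ)
ηT = ƛ (ƛ (ƛ (v1 · v2)))

-- β_A = λ φ x e b. b (λ y. φ y e b) x
βT : ∀ {Γ A} → T Γ ((ι ⇒ ChD A ι) ⇒ ι ⇒ ChD A ι)
βT = ƛ (ƛ (ƛ (ƛ (v0 · ƛ (v4 · v0 · v2 · v1) · v2))))

-- K_A = λ f d e' b'. d (λ x. f x e' b') b'
KT : ∀ {Γ A σ τ} → T Γ ((σ ⇒ ChD A τ) ⇒ ChD A σ ⇒ ChD A τ)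
KT = ƛ (ƛ (ƛ (ƛ (v2 · ƛ (v4 · v0 · v2 · v1) · v0))))

-- map_A = λ f. K_A (λ x. η_A (f x))
mapT : ∀ {Γ A σ τ} → T Γ ((σ ⇒ τ) ⇒ ChD A σ ⇒ ChD A τ)
mapT = ƛ (KT · ƛ (ηT · (v1 · v0)))

⌈_⌉ty : Type → Type → Type
⌈ ι ⌉ty A     = ChD A ι
⌈ σ ⇒ τ ⌉ty A = ⌈ σ ⌉ty A ⇒ ⌈ τ ⌉ty A

⌈_⌉cxt : Cxt → Type → Cxt
⌈ ε ⌉cxt A      = ε
⌈ Γ ,, σ ⌉cxt A = ⌈ Γ ⌉cxt A ,, ⌈ σ ⌉ty A

⌈_⌉var : ∀ {Γ σ} → Γ ∋ σ → (A : Type) → ⌈ Γ ⌉cxt A ∋ ⌈ σ ⌉ty A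
⌈ here ⌉var A    = here
⌈ there i ⌉var A = there (⌈ i ⌉var A)

extT : ∀ {Γ} → (σ A : Type) → T Γ ((ι ⇒ ⌈ σ ⌉ty A) ⇒ ⌈ ι ⌉ty A ⇒ ⌈ σ ⌉ty A)
extT ι         A = KT
extT (σ₁ ⇒ σ₂) A = ƛ (ƛ (ƛ (extT σ₂ A · ƛ (v3 · v0 · v1) · v1)))

⌈_⌉ : ∀ {Γ σ} → T Γ σ → (A : Type) → T (⌈ Γ ⌉cxt A) (⌈ σ ⌉ty A)
⌈ ν i ⌉ A                 = ν (⌈ i ⌉var A)
⌈ Zero ⌉ A                = ηT · Zero
⌈ Succ t ⌉ A              = mapT · ƛ (Succ v0) · ⌈ t ⌉ A
⌈ Rec {σ = σ} t₁ t₂ t₃ ⌉ A =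
  extT σ A · ƛ (Rec (ƛ (wk (wk (⌈ t₁ ⌉ A)) · (ηT · v0))) (wk (⌈ t₂ ⌉ A)) v0) · ⌈ t₃ ⌉ A
⌈ ƛ t ⌉ A                 = ƛ (⌈ t ⌉ A)
⌈ t · u ⌉ A               = ⌈ t ⌉ A · ⌈ u ⌉ A

-- generic_A = K_A (λ i. β_A η_A i)
genericT : ∀ {Γ A} → T Γ (ChD A ι ⇒ ChD A ι)
genericT = KT · ƛ (βT · ηT · v0)

dialogueTree : (A : Type) → T ε ((ι ⇒ ι) ⇒ ι) → T ε (ChD A ι)
dialogueTree A t = ⌈ t ⌉ A · genericT

maxBQT : ∀ {Γ} → (maxT : T ε (ι ⇒ ι ⇒ ι)) → T Γ (ChD ι ι ⇒ ι)
maxBQT maxT =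
  ƛ (v0 · ƛ Zero
        · ƛ (ƛ (close maxT · v0 · (close maxT · (v1 · numeral 0) · (v1 · numeral 1)))))

modulusUniT : ∀ {Γ} → (maxT : T ε (ι ⇒ ι ⇒ ι)) → T Γ (ChD ι ι ⇒ ι)
modulusUniT maxT = ƛ (Succ (maxBQT maxT · v0))

module Submission where

open import Defs
open import Data.Nat using (ℕ; zero; suc; _≤_; _<_; _⊔_; s≤s)
open import Data.Nat.Properties using (m≤m⊔n; m≤n⊔m; ≤-trans)
open import Data.Bool using (Bool; true; false)
open import Data.Unit using (tt)
open import Data.Product using (Σ-syntax; _×_; _,_; proj₁; proj₂)
open import Function using (id; _∘_)
open import Relation.Binary.PropositionalEquality
  using (_≡_; refl; sym; trans; cong; cong₂; subst; module ≡-Reasoning)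

-- The term ⌈ t ⌉ ι · generic is a Church encoding of a dialogue tree D for
-- the functional ⟦ t ⟧: a logical relation between the set interpretation
-- and the translation shows ⟦ t ⟧ f = dialogue f D for every f.  Feeding
-- maxBQ the fold "take the maximum of the query and both subtrees" computes
-- the largest index queried along the Boolean paths of D, and two Boolean
-- sequences agreeing up to it follow the same path through D.

Natrec-preserves : {X Y : Set} (S : X → Y → Set) {f : ℕ → X → X} {g : ℕ → Y → Y} {x : X} {y : Y} →
  (∀ n {a b} → S a b → S (f n a) (g n b)) → S x y → ∀ n → S (Natrec f x n) (Natrec g y n)
Natrec-preserves S step base zero    = base
Natrec-preserves S step base (suc n) = step n (Natrec-preserves S step base n)

data Tree : Set where
  leaf   : ℕ → Tree
  branch : (ℕ → Tree) → ℕ → Tree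

fold : {X : Set} → (ℕ → X) → ((ℕ → X) → ℕ → X) → Tree → X
fold e b (leaf n)     = e n
fold e b (branch φ i) = b (λ y → fold e b (φ y)) i

dialogue : (ℕ → ℕ) → Tree → ℕ
dialogue f (leaf n)     = n
dialogue f (branch φ i) = dialogue f (φ (f i))

bind : (ℕ → Tree) → Tree → Tree
bind F (leaf n)     = F n
bind F (branch φ i) = branch (λ y → bind F (φ y)) i

dialogue-bind : ∀ f F D → dialogue f (bind F D) ≡ dialogue f (F (dialogue f D))
dialogue-bind f F (leaf n)     = refl
dialogue-bind f F (branch φ i) = dialogue-bind f F (φ (f i))

query : (ℕ → ℕ) → (ℕ → ℕ) → ℕ → ℕ
query f g i = g (f i)

fold-query : ∀ f D → fold id (query f) D ≡ dialogue f D
fold-query f (leaf n)     = refl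
fold-query f (branch φ i) = fold-query f (φ (f i))

maxQuery : Tree → ℕ
maxQuery (leaf n)     = 0
maxQuery (branch φ i) = i ⊔ (maxQuery (φ 0) ⊔ maxQuery (φ 1))

bit : Bool → ℕ
bit false = 0
bit true  = 1

embed≡bit : ∀ α i → embed α i ≡ bit (α i)
embed≡bit α i with α i
... | false = refl
... | true  = refl

maxQuery-bit-child : ∀ (φ : ℕ → Tree) b → maxQuery (φ (bit b)) ≤ maxQuery (φ 0) ⊔ maxQuery (φ 1)
maxQuery-bit-child φ false = m≤m⊔n _ _
maxQuery-bit-child φ true  = m≤n⊔m _ _

maxQuery-modulus : ∀ (α β : ℕ → Bool) D → (∀ i → i < suc (maxQuery D) → α i ≡ β i) →
  dialogue (embed α) D ≡ dialogue (embed β) D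
maxQuery-modulus α β (leaf n)     agree = refl
maxQuery-modulus α β (branch φ i) agree =
  begin
    dialogue (embed α) (φ (embed α i)) ≡⟨ cong (dialogue (embed α) ∘ φ) same-answer ⟩
    dialogue (embed α) (φ (embed β i)) ≡⟨ maxQuery-modulus α β (φ (embed β i)) agree-child ⟩
    dialogue (embed β) (φ (embed β i)) ∎
  where
  open ≡-Reasoning
  same-answer : embed α i ≡ embed β i
  same-answer = trans (embed≡bit α i)
    (trans (cong bit (agree i (s≤s (m≤m⊔n i _)))) (sym (embed≡bit β i)))
  child≤ : maxQuery (φ (embed β i)) ≤ maxQuery (branch φ i)
  child≤ = ≤-trans (subst (λ k → maxQuery (φ k) ≤ _) (sym (embed≡bit β i)) (maxQuery-bit-child φ (β i)))
                   (m≤n⊔m i _)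
  agree-child : ∀ j → j < suc (maxQuery (φ (embed β i))) → α j ≡ β j
  agree-child j j< = agree j (≤-trans j< (s≤s child≤))

Extensional : {X : Set} → ((ℕ → X) → ℕ → X) → Set
Extensional b = ∀ g g′ i → (∀ y → g y ≡ g′ y) → b g i ≡ b g′ i

-- Quantifying only over extensional b is what lets encodings be composed by
-- bind (encodes-bind) without function extensionality.
_Encodes_ : {A : Type} → ⟦ ChD A ι ⟧ty → Tree → Set
d Encodes D = ∀ e b → Extensional b → d e b ≡ fold e b D

encodes-bind : ∀ {A} (d : ⟦ ChD A ι ⟧ty) D (g : ℕ → ⟦ ChD A ι ⟧ty) F →
  d Encodes D → (∀ n → g n Encodes F n) → (λ e b → d (λ n → g n e b) b) Encodes bind F D
encodes-bind d D g F d≈D g≈F e b ext-b = trans (d≈D (λ n → g n e b) b ext-b) (fold-bind D)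
  where
  fold-bind : ∀ D → fold (λ n → g n e b) b D ≡ fold e b (bind F D)
  fold-bind (leaf n)     = g≈F n e b ext-b
  fold-bind (branch φ i) = ext-b _ _ i (λ y → fold-bind (φ y))

encodes-dialogue : ∀ f {d} D → _Encodes_ {ι} d D → dialogue f D ≡ d id (query f)
encodes-dialogue f D d≈D =
  trans (sym (fold-query f D)) (sym (d≈D id (query f) (λ g g′ i g≗g′ → g≗g′ (f i))))

ren-cong : ∀ {Γ Δ σ} {ρ ρ′ : Ren Γ Δ} → (∀ {τ} (i : Γ ∋ τ) → ρ i ≡ ρ′ i) →
  (u : T Γ σ) → ren ρ u ≡ ren ρ′ u
ren-cong h (ν i)       = cong ν (h i)
ren-cong h Zero        = refl
ren-cong h (Succ u)    = cong Succ (ren-cong h u)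
ren-cong h (Rec u p q) rewrite ren-cong h u | ren-cong h p | ren-cong h q = refl
ren-cong {ρ = ρ} {ρ′} h (ƛ u) = cong ƛ (ren-cong lift-h u)
  where
  lift-h : ∀ {τ σ} (i : _ ∋ τ) → liftRen {τ = σ} ρ i ≡ liftRen ρ′ i
  lift-h here      = refl
  lift-h (there i) = cong there (h i)
ren-cong h (u · v)     = cong₂ _·_ (ren-cong h u) (ren-cong h v)

ren-∘ : ∀ {Γ Δ Θ σ} (ρ : Ren Δ Θ) (ρ′ : Ren Γ Δ) (u : T Γ σ) → ren ρ (ren ρ′ u) ≡ ren (ρ ∘ ρ′) u
ren-∘ ρ ρ′ (ν i)       = refl
ren-∘ ρ ρ′ Zero        = refl
ren-∘ ρ ρ′ (Succ u)    = cong Succ (ren-∘ ρ ρ′ u)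
ren-∘ ρ ρ′ (Rec u p q) rewrite ren-∘ ρ ρ′ u | ren-∘ ρ ρ′ p | ren-∘ ρ ρ′ q = refl
ren-∘ ρ ρ′ (ƛ u)       = cong ƛ (trans (ren-∘ (liftRen ρ) (liftRen ρ′) u) (ren-cong lift-∘ u))
  where
  lift-∘ : ∀ {τ σ} (i : _ ∋ τ) → liftRen {τ = σ} ρ (liftRen ρ′ i) ≡ liftRen (ρ ∘ ρ′) i
  lift-∘ here      = refl
  lift-∘ (there i) = refl
ren-∘ ρ ρ′ (u · v)     = cong₂ _·_ (ren-∘ ρ ρ′ u) (ren-∘ ρ ρ′ v)

ren-id : ∀ {Γ σ} (u : T Γ σ) → ren id u ≡ u
ren-id (ν i)       = refl
ren-id Zero        = refl
ren-id (Succ u)    = cong Succ (ren-id u)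
ren-id (Rec u p q) rewrite ren-id u | ren-id p | ren-id q = refl
ren-id (ƛ u)       = cong ƛ (trans (ren-cong lift-id u) (ren-id u))
  where
  lift-id : ∀ {τ σ} (i : _ ∋ τ) → liftRen {τ = σ} id i ≡ i
  lift-id here      = refl
  lift-id (there i) = refl
ren-id (u · v)     = cong₂ _·_ (ren-id u) (ren-id v)

ren-extT : ∀ σ A {Γ Δ} (ρ : Ren Γ Δ) → ren ρ (extT σ A) ≡ extT σ A
ren-extT ι         A ρ = refl
ren-extT (σ₁ ⇒ σ₂) A ρ = cong (λ e → ƛ (ƛ (ƛ (e · ƛ (v3 · v0 · v1) · v1)))) (ren-extT σ₂ A _)

module _ {A : Type} (f : ℕ → ℕ) where

  R : (σ : Type) → ⟦ σ ⟧ty → ⟦ ⌈ σ ⌉ty A ⟧ty → Set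
  R ι       x d = Σ[ D ∈ Tree ] (d Encodes D × dialogue f D ≡ x)
  R (σ ⇒ τ) a d = ∀ x e → R σ x e → R τ (a x) (d e)

  R-η : ∀ n → R ι n (λ e b → e n)
  R-η n = leaf n , (λ e b _ → refl) , refl

  R-bind : ∀ (F : ℕ → ℕ) (g : ℕ → ⟦ ChD A ι ⟧ty) → (∀ n → R ι (F n) (g n)) →
    ∀ {x d} → R ι x d → R ι (F x) (λ e b → d (λ n → g n e b) b)
  R-bind F g Fg {x} {d} (D , d≈D , D→x) =
    bind (λ n → proj₁ (Fg n)) D ,
    encodes-bind d D g _ d≈D (λ n → proj₁ (proj₂ (Fg n))) ,
    (begin
      dialogue f (bind (λ n → proj₁ (Fg n)) D) ≡⟨ dialogue-bind f _ D ⟩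
      dialogue f (proj₁ (Fg (dialogue f D)))   ≡⟨ cong (λ n → dialogue f (proj₁ (Fg n))) D→x ⟩
      dialogue f (proj₁ (Fg x))                ≡⟨ proj₂ (proj₂ (Fg x)) ⟩
      F x                                      ∎)
    where open ≡-Reasoning

  R-extT : ∀ σ {Γ} (γ : ⟦ Γ ⟧cxt) (k : ℕ → ⟦ σ ⟧ty) (h : ℕ → ⟦ ⌈ σ ⌉ty A ⟧ty) →
    (∀ n → R σ (k n) (h n)) → ∀ {x d} → R ι x d → R σ (k x) (⟦ extT σ A ⟧ γ h d)
  R-extT ι         γ k h kh = R-bind k h kh
  R-extT (σ₁ ⇒ σ₂) γ k h kh {d = d} xd y s ys =
    R-extT σ₂ (((γ , h) , d) , s) (λ n → k n y) (λ n → h n s) (λ n → kh n y s ys) xd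

  R-Rec : ∀ σ {Γ} (γ : ⟦ Γ ⟧cxt) (a : ℕ → ⟦ σ ⟧ty → ⟦ σ ⟧ty) (a₀ : ⟦ σ ⟧ty)
    (G : ℕ → ℕ → ⟦ ⌈ ι ⇒ σ ⇒ σ ⌉ty A ⟧ty) (Y : ℕ → ⟦ ⌈ σ ⌉ty A ⟧ty) →
    (∀ n x → R (ι ⇒ σ ⇒ σ) a (G n x)) → (∀ n → R σ a₀ (Y n)) → ∀ {x d} → R ι x d →
    R σ (Natrec a a₀ x) (⟦ extT σ A ⟧ γ (λ n → Natrec (λ k → G n k (λ e b → e k)) (Y n) n) d)
  R-Rec σ γ a a₀ G Y RG RY =
    R-extT σ γ (Natrec a a₀) _
      (λ n → Natrec-preserves (R σ) (λ m {x} {e} → RG n m m _ (R-η m) x e) (RY n) n)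

  RelEnv : ∀ {Γ Δ} → Ren (⌈ Γ ⌉cxt A) Δ → ⟦ Γ ⟧cxt → ⟦ Δ ⟧cxt → Set
  RelEnv {Γ} ρ γ δ = ∀ {τ} (i : Γ ∋ τ) → R τ (lookupEnv i γ) (lookupEnv (ρ (⌈ i ⌉var A)) δ)

  -- The renaming ρ is needed to go under the weakenings in the translation of Rec.
  fundamental : ∀ {Γ σ} (t : T Γ σ) {Δ} (ρ : Ren (⌈ Γ ⌉cxt A) Δ) (γ : ⟦ Γ ⟧cxt) (δ : ⟦ Δ ⟧cxt) →
    RelEnv ρ γ δ → R σ (⟦ t ⟧ γ) (⟦ ren ρ (⌈ t ⌉ A) ⟧ δ)
  fundamental (ν i)    ρ γ δ H = H i
  fundamental Zero     ρ γ δ H = R-η 0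
  fundamental (Succ t) ρ γ δ H = R-bind suc _ (λ n → R-η (suc n)) (fundamental t ρ γ δ H)
  fundamental (ƛ t)    ρ γ δ H x e xe = fundamental t (liftRen ρ) (γ , x) (δ , e) H′
    where
    H′ : RelEnv (liftRen ρ) (γ , x) (δ , e)
    H′ here      = xe
    H′ (there i) = H i
  fundamental (t · u)  ρ γ δ H = fundamental t ρ γ δ H _ _ (fundamental u ρ γ δ H)
  fundamental {σ = σ} (Rec t₁ t₂ t₃) ρ γ δ H rewrite ren-extT σ A ρ =
    R-Rec σ δ (⟦ t₁ ⟧ γ) (⟦ t₂ ⟧ γ) _ _ R₁ R₂ (fundamental t₃ ρ γ δ H)
    where
    R₁ : ∀ n x → R (ι ⇒ σ ⇒ σ) (⟦ t₁ ⟧ γ)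
                   (⟦ ren (liftRen (liftRen ρ)) (wk (wk (⌈ t₁ ⌉ A))) ⟧ ((δ , n) , x))
    R₁ n x = subst (λ E → R _ (⟦ t₁ ⟧ γ) (⟦ E ⟧ ((δ , n) , x)))
      (sym (trans (ren-∘ _ there (wk (⌈ t₁ ⌉ A))) (ren-∘ _ there (⌈ t₁ ⌉ A))))
      (fundamental t₁ (there ∘ there ∘ ρ) γ ((δ , n) , x) H)
    R₂ : ∀ n → R σ (⟦ t₂ ⟧ γ) (⟦ ren (liftRen ρ) (wk (⌈ t₂ ⌉ A)) ⟧ (δ , n))
    R₂ n = subst (λ E → R σ (⟦ t₂ ⟧ γ) (⟦ E ⟧ (δ , n))) (sym (ren-∘ _ there (⌈ t₂ ⌉ A)))
      (fundamental t₂ (there ∘ ρ) γ (δ , n) H)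

  R-generic : R (ι ⇒ ι) f ⟦ genericT {ε} {A} ⟧₀
  R-generic x d = R-bind f _ (λ i → branch leaf i , (λ e b _ → refl) , refl)

  R-dialogueTree : (t : T ε ((ι ⇒ ι) ⇒ ι)) → R ι (⟦ t ⟧₀ f) ⟦ dialogueTree A t ⟧₀
  R-dialogueTree t =
    subst (λ E → R ((ι ⇒ ι) ⇒ ι) ⟦ t ⟧₀ (⟦ E ⟧ tt)) (ren-id (⌈ t ⌉ A))
      (fundamental t id tt tt (λ ())) f _ R-generic

dialogueTree-encodes : ∀ A (t : T ε ((ι ⇒ ι) ⇒ ι)) → Σ[ D ∈ Tree ] (⟦ dialogueTree A t ⟧₀ Encodes D)
dialogueTree-encodes A t with R-dialogueTree id t
... | D , d≈D , _ = D , d≈D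

dialogueTree-correct : ∀ f (t : T ε ((ι ⇒ ι) ⇒ ι)) → ⟦ t ⟧₀ f ≡ ⟦ dialogueTree ι t ⟧₀ id (query f)
dialogueTree-correct f t with R-dialogueTree f t
... | D , d≈D , D→t = trans (sym D→t) (encodes-dialogue f D d≈D)

ExtEq : (σ : Type) → ⟦ σ ⟧ty → ⟦ σ ⟧ty → Set
ExtEq ι       x y = x ≡ y
ExtEq (σ ⇒ τ) a b = ∀ x y → ExtEq σ x y → ExtEq τ (a x) (b y)

ren-ExtEq : ∀ {Γ Δ σ} (u : T Γ σ) (ρ : Ren Γ Δ) (γ : ⟦ Γ ⟧cxt) (δ : ⟦ Δ ⟧cxt) →
  (∀ {τ} (i : Γ ∋ τ) → ExtEq τ (lookupEnv (ρ i) δ) (lookupEnv i γ)) →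
  ExtEq σ (⟦ ren ρ u ⟧ δ) (⟦ u ⟧ γ)
ren-ExtEq (ν i)      ρ γ δ H = H i
ren-ExtEq Zero       ρ γ δ H = refl
ren-ExtEq (Succ u)   ρ γ δ H = cong suc (ren-ExtEq u ρ γ δ H)
ren-ExtEq {σ = σ} (Rec u p q) ρ γ δ H rewrite ren-ExtEq q ρ γ δ H =
  Natrec-preserves (ExtEq σ) (λ n {a} {b} → ren-ExtEq u ρ γ δ H n n refl a b)
    (ren-ExtEq p ρ γ δ H) (⟦ q ⟧ γ)
ren-ExtEq (ƛ u)      ρ γ δ H x y xy = ren-ExtEq u (liftRen ρ) (γ , y) (δ , x) H′
  where
  H′ : ∀ {τ} i → ExtEq τ (lookupEnv (liftRen ρ i) (δ , x)) (lookupEnv i (γ , y))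
  H′ here      = xy
  H′ (there i) = H i
ren-ExtEq (u · v)    ρ γ δ H = ren-ExtEq u ρ γ δ H _ _ (ren-ExtEq v ρ γ δ H)

-- ⟦ close u ⟧ γ is not definitionally ⟦ u ⟧₀, and without function
-- extensionality the two agree only up to ExtEq.
close-ExtEq : ∀ {Γ σ} (u : T ε σ) (γ : ⟦ Γ ⟧cxt) → ExtEq σ (⟦ close u ⟧ γ) ⟦ u ⟧₀
close-ExtEq u γ = ren-ExtEq u _ tt γ (λ ())

fold-maxQuery : (b : (ℕ → ℕ) → ℕ → ℕ) → (∀ g i → b g i ≡ i ⊔ (g 0 ⊔ g 1)) →
  ∀ D → fold (λ _ → 0) b D ≡ maxQuery D
fold-maxQuery b b≡ (leaf n)     = refl
fold-maxQuery b b≡ (branch φ i) =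
  trans (b≡ _ i) (cong₂ (λ l r → i ⊔ (l ⊔ r)) (fold-maxQuery b b≡ (φ 0)) (fold-maxQuery b b≡ (φ 1)))

maxBQ-maxQuery : (maxT : T ε (ι ⇒ ι ⇒ ι)) → (∀ a b → ⟦ maxT ⟧₀ a b ≡ a ⊔ b) →
  ∀ {Γ} (γ : ⟦ Γ ⟧cxt) d D → _Encodes_ {ι} d D → ⟦ maxBQT maxT ⟧ γ d ≡ maxQuery D
maxBQ-maxQuery maxT maxT≡⊔ γ d D d≈D =
  trans (d≈D _ b extensional) (fold-maxQuery b b≡ D)
  where
  max≡⊔ : ∀ {Δ} (δ : ⟦ Δ ⟧cxt) a b → ⟦ close maxT ⟧ δ a b ≡ a ⊔ b
  max≡⊔ δ a b = trans (close-ExtEq maxT δ a a refl b b refl) (maxT≡⊔ a b)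
  b : (ℕ → ℕ) → ℕ → ℕ
  b g i = let δ = (((γ , d) , g) , i) in ⟦ close maxT ⟧ δ i (⟦ close maxT ⟧ δ (g 0) (g 1))
  b≡ : ∀ g i → b g i ≡ i ⊔ (g 0 ⊔ g 1)
  b≡ g i = trans (max≡⊔ _ i _) (cong (i ⊔_) (max≡⊔ _ (g 0) (g 1)))
  extensional : Extensional b
  extensional g g′ i g≗g′ =
    trans (b≡ g i) (trans (cong₂ (λ l r → i ⊔ (l ⊔ r)) (g≗g′ 0) (g≗g′ 1)) (sym (b≡ g′ i)))

theorem55 : (maxT : T ε (ι ⇒ ι ⇒ ι)) → (∀ a b → ⟦ maxT ⟧₀ a b ≡ a ⊔ b) →
    (t : T ε ((ι ⇒ ι) ⇒ ι)) →
    (α β : ℕ → Bool) →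
    (∀ i → i < ⟦ modulusUniT maxT · dialogueTree ι t ⟧₀ → α i ≡ β i) →
    ⟦ t ⟧₀ (embed α) ≡ ⟦ t ⟧₀ (embed β)
theorem55 maxT maxT≡⊔ t α β agree with dialogueTree-encodes ι t
... | D , d≈D =
  begin
    ⟦ t ⟧₀ (embed α)                           ≡⟨ dialogueTree-correct (embed α) t ⟩
    ⟦ dialogueTree ι t ⟧₀ id (query (embed α)) ≡⟨ sym (encodes-dialogue (embed α) D d≈D) ⟩
    dialogue (embed α) D                       ≡⟨ maxQuery-modulus α β D agree-below ⟩
    dialogue (embed β) D                       ≡⟨ encodes-dialogue (embed β) D d≈D ⟩
    ⟦ dialogueTree ι t ⟧₀ id (query (embed β)) ≡⟨ sym (dialogueTree-correct (embed β) t) ⟩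
    ⟦ t ⟧₀ (embed β)                           ∎
  where
  open ≡-Reasoning
  modulus≡ : ⟦ modulusUniT maxT · dialogueTree ι t ⟧₀ ≡ suc (maxQuery D)
  modulus≡ = cong suc (maxBQ-maxQuery maxT maxT≡⊔ _ _ D d≈D)
  agree-below : ∀ i → i < suc (maxQuery D) → α i ≡ β i
  agree-below i i< = agree i (subst (i <_) (sym modulus≡) i<)
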